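{- If an atomic flow $A$ is normal for $\mathsf c$ and $A\to_{\mathsf w}^\star B$, then $B$ is normal for $\mathsf c$.
   Context: An atomic flow is a finite directed acyclic graph whose vertices are labelled interaction (0 upper edges, 2 lower edges), cointeraction (2 upper, 0 lower), weakening (0,1), coweakening (1,0), contraction (2,1) or cocontraction (1,2); edges may also have a dangling upper or lower end; there is a polarity assignment in $\{+,-\}$ with equal polarities on the edges of a (co)contraction and distinct ones on the two edges of a (co)interaction. A flow is normal for a rewriting system if no rule of the system applies to it. System $\mathsf c$: (1) a contraction with upper edges $\epsilon_1,\epsilon_2$ whose lower edge is an upper edge of a cointeraction with other upper edge $\epsilon_3$ is replaced by a cocontraction with upper edge $\epsilon_3$ and lower edges $\delta_1,\delta_2$ and cointeractions with upper edges $\{\epsilon_1,\delta_1\}$, $\{\epsilon_2,\delta_2\}$; (2) an interaction with lower edges $\epsilon_3,\epsilon$, where $\epsilon$ is the upper edge of a cocontraction with lower edges $\epsilon_1,\epsilon_2$, is replaced by a contraction with lower edge $\epsilon_3$ and upper edges $\delta_1,\delta_2$ and interactions with lower edges $\{\epsilon_1,\delta_1\}$, $\{\epsilon_2,\delta_2\}$; (3) a contraction whose lower edge is the upper edge of a cocontraction is replaced by two cocontractions (on the contraction's upper edges) and two contractions (on the cocontraction's lower edges), each cocontraction joined to each contraction. System $\mathsf w$: (1) a weakening whose lower edge is an upper edge of a contraction: delete both and that edge, merging the contraction's other upper edge with its lower edge; (2) a cocontraction one of whose lower edges is the upper edge of a coweakening: delete both and that edge, merging the cocontraction's upper edge with its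 other lower edge; (3) a weakening whose lower edge is an upper edge of a cointeraction: delete both and that edge, the other upper edge of the cointeraction gets a new coweakening; (4) an interaction one of whose lower edges enters a coweakening: delete both and that edge, the other lower edge gets a new weakening; (5) a weakening whose lower edge enters a coweakening: delete both and the edge; (6) a weakening whose lower edge is the upper edge of a cocontraction: delete both and that edge, each lower edge of the cocontraction gets a new weakening; (7) a contraction whose lower edge enters a coweakening: delete both and that edge, each upper edge of the contraction gets a new coweakening. $\to_{\mathsf w}^\star$ is the reflexive–transitive closure. -}

module Defs where

open import Data.Nat using (ℕ; zero; suc)
open import Data.Bool using (Bool; true; false; if_then_else_; not; _∧_)
open import Data.Fin using (Fin; zero)
open import Data.Fin.Properties using (_≟_)
open import Data.List using (List; map; allFin)
open import Data.Nat.ListAction using (sum)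
open import Data.Maybe using (Maybe; just; nothing)
import Data.Maybe as M
open import Data.Sum using (_⊎_; inj₁; inj₂)
open import Data.Product using (Σ; ∃; _×_; _,_)
open import Relation.Nullary using (¬_; Dec; yes; no)
open import Relation.Nullary.Decidable using (⌊_⌋)
open import Relation.Binary.PropositionalEquality using (_≡_; _≢_)
open import Relation.Binary.Construct.Closure.Transitive using (TransClosure)
open import Relation.Binary.Construct.Closure.ReflexiveTransitive using (Star)
open import Function using (Injective)

-- For an edge e, `top e` is the vertex at its upper end (e is a LOWER
-- edge of that vertex), `bot e` the vertex at its lower end (e is an
-- UPPER edge of that vertex); `nothing` means the end is dangling.

data Kind : Set where
  interaction cointeraction weakening coweakening contraction cocontraction : Kind

data Pol : Set where
  plus minus : Pol

upperArity : Kind → ℕ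
upperArity interaction   = 0
upperArity cointeraction = 2
upperArity weakening     = 0
upperArity coweakening   = 1
upperArity contraction   = 2
upperArity cocontraction = 1

lowerArity : Kind → ℕ
lowerArity interaction   = 2
lowerArity cointeraction = 0
lowerArity weakening     = 1
lowerArity coweakening   = 0
lowerArity contraction   = 1
lowerArity cocontraction = 2

record Flow : Set where
  field
    nV  : ℕ
    nE  : ℕ
    lab : Fin nV → Kind
    top : Fin nE → Maybe (Fin nV)
    bot : Fin nE → Maybe (Fin nV)
    pol : Fin nE → Pol

open Flow public

at : ∀ {n} → Maybe (Fin n) → Fin n → Bool
at (just u) v = ⌊ u ≟ v ⌋
at nothing  v = false

count : ∀ {m} → (Fin m → Bool) → ℕ
count {m} p = sum (map (λ e → if p e then 1 else 0) (allFin m))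

Step : (A : Flow) → Fin (nV A) → Fin (nV A) → Set
Step A v w = ∃ λ e → top A e ≡ just v × bot A e ≡ just w

record IsAtomicFlow (A : Flow) : Set where
  field
    upper-arity : ∀ v → count (λ e → at (bot A e) v) ≡ upperArity (lab A v)
    lower-arity : ∀ v → count (λ e → at (top A e) v) ≡ lowerArity (lab A v)
    pol-contraction : ∀ v → lab A v ≡ contraction →
      ∀ e e' → (bot A e ≡ just v ⊎ top A e ≡ just v) →
               (bot A e' ≡ just v ⊎ top A e' ≡ just v) → pol A e ≡ pol A e'
    pol-cocontraction : ∀ v → lab A v ≡ cocontraction →
      ∀ e e' → (bot A e ≡ just v ⊎ top A e ≡ just v) →
               (bot A e' ≡ just v ⊎ top A e' ≡ just v) → pol A e ≡ pol A e'
    pol-interaction : ∀ v → lab A v ≡ interaction →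
      ∀ e e' → top A e ≡ just v → top A e' ≡ just v → e ≢ e' → pol A e ≢ pol A e'
    pol-cointeraction : ∀ v → lab A v ≡ cointeraction →
      ∀ e e' → bot A e ≡ just v → bot A e' ≡ just v → e ≢ e' → pol A e ≢ pol A e'
    acyclic : ∀ v → ¬ TransClosure (Step A) v v

data CRedex (A : Flow) : Set where
  -- (1) contraction (upper ε₁ ε₂, lower ε) ; ε and ε₃ upper edges of a cointeraction
  c1 : (c ci : Fin (nV A)) (ε₁ ε₂ ε ε₃ : Fin (nE A)) →
       lab A c ≡ contraction → lab A ci ≡ cointeraction →
       bot A ε₁ ≡ just c → bot A ε₂ ≡ just c → ε₁ ≢ ε₂ →
       top A ε ≡ just c → bot A ε ≡ just ci →
       bot A ε₃ ≡ just ci → ε₃ ≢ ε → CRedex A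
  -- (2) interaction with lower edges ε₃ ε ; ε upper edge of a cocontraction
  --     with lower edges ε₁ ε₂
  c2 : (i k : Fin (nV A)) (ε₃ ε ε₁ ε₂ : Fin (nE A)) →
       lab A i ≡ interaction → lab A k ≡ cocontraction →
       top A ε₃ ≡ just i → top A ε ≡ just i → ε₃ ≢ ε →
       bot A ε ≡ just k →
       top A ε₁ ≡ just k → top A ε₂ ≡ just k → ε₁ ≢ ε₂ → CRedex A
  -- (3) contraction (upper ε₁ ε₂) whose lower edge ε is the upper edge of a
  --     cocontraction (lower ε₃ ε₄)
  c3 : (c k : Fin (nV A)) (ε₁ ε₂ ε ε₃ ε₄ : Fin (nE A)) →
       lab A c ≡ contraction → lab A k ≡ cocontraction →
       bot A ε₁ ≡ just c → bot A ε₂ ≡ just c → ε₁ ≢ ε₂ →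
       top A ε ≡ just c → bot A ε ≡ just k →
       top A ε₃ ≡ just k → top A ε₄ ≡ just k → ε₃ ≢ ε₄ → CRedex A

NormalC : Flow → Set
NormalC A = ¬ CRedex A

-- A `Spec A` describes the result of a local rewrite
-- of A: vertices of the result are the kept vertices of A plus k new
-- vertices, edges are the kept edges of A; labels and edge ends are
-- given by lab', top', bot'; polarities are those of A.

record Spec (A : Flow) : Set where
  field
    k     : ℕ
    keepV : Fin (nV A) → Bool
    keepE : Fin (nE A) → Bool
    lab'  : Fin (nV A) ⊎ Fin k → Kind
    top'  : Fin (nE A) → Maybe (Fin (nV A) ⊎ Fin k)
    bot'  : Fin (nE A) → Maybe (Fin (nV A) ⊎ Fin k)

keptV : ∀ {A} (S : Spec A) → Fin (nV A) ⊎ Fin (Spec.k S) → Bool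
keptV S (inj₁ v) = Spec.keepV S v
keptV S (inj₂ _) = true

-- B is (isomorphic to) the flow described by S
record Realises {A : Flow} (S : Spec A) (B : Flow) : Set where
  field
    ν     : Fin (nV B) → Fin (nV A) ⊎ Fin (Spec.k S)
    ν-inj : Injective _≡_ _≡_ ν
    ν-img : ∀ x → keptV S x ≡ true → ∃ λ v → ν v ≡ x
    ν-ok  : ∀ v → keptV S (ν v) ≡ true
    μ     : Fin (nE B) → Fin (nE A)
    μ-inj : Injective _≡_ _≡_ μ
    μ-img : ∀ e → Spec.keepE S e ≡ true → ∃ λ b → μ b ≡ e
    μ-ok  : ∀ b → Spec.keepE S (μ b) ≡ true
    lab≡  : ∀ v → lab B v ≡ Spec.lab' S (ν v)
    pol≡  : ∀ b → pol B b ≡ pol A (μ b)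
    top≡  : ∀ b → M.map ν (top B b) ≡ Spec.top' S (μ b)
    bot≡  : ∀ b → M.map ν (bot B b) ≡ Spec.bot' S (μ b)

_=ᵇ_ : ∀ {n} → Fin n → Fin n → Bool
u =ᵇ v = ⌊ u ≟ v ⌋

old : ∀ {n k} → Maybe (Fin n) → Maybe (Fin n ⊎ Fin k)
old = M.map inj₁

module _ (A : Flow) where
  relabel : ∀ {k} → Fin (nV A) → Kind → Fin (nV A) ⊎ Fin k → Kind
  relabel x K (inj₁ v) = if v =ᵇ x then K else lab A v
  relabel x K (inj₂ _) = weakening  -- overridden where new vertices occur

data _⟶w_ (A : Flow) (B : Flow) : Set where
  -- (1) weakening w, lower edge ε into contraction c with other upper edge ε'
  --     and lower edge δ: delete w, c, ε; merge ε' with δ.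
  w1 : (w c : Fin (nV A)) (ε ε' δ : Fin (nE A)) →
       lab A w ≡ weakening → lab A c ≡ contraction →
       top A ε ≡ just w → bot A ε ≡ just c →
       bot A ε' ≡ just c → ε' ≢ ε → top A δ ≡ just c →
       Realises {A} (record
         { k = 0
         ; keepV = λ v → not (v =ᵇ w) ∧ not (v =ᵇ c)
         ; keepE = λ e → not (e =ᵇ ε) ∧ not (e =ᵇ δ)
         ; lab' = λ { (inj₁ v) → lab A v ; (inj₂ ()) }
         ; top' = λ e → old (top A e)
         ; bot' = λ e → if e =ᵇ ε' then old (bot A δ) else old (bot A e)
         }) B → A ⟶w B
  -- (2) cocontraction k with upper edge δ and lower edges ε ε', ε into a
  --     coweakening z: delete k, z, ε; merge δ with ε'.
  w2 : (k z : Fin (nV A)) (δ ε ε' : Fin (nE A)) →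
       lab A k ≡ cocontraction → lab A z ≡ coweakening →
       top A ε ≡ just k → bot A ε ≡ just z →
       top A ε' ≡ just k → ε' ≢ ε → bot A δ ≡ just k →
       Realises {A} (record
         { k = 0
         ; keepV = λ v → not (v =ᵇ k) ∧ not (v =ᵇ z)
         ; keepE = λ e → not (e =ᵇ ε) ∧ not (e =ᵇ ε')
         ; lab' = λ { (inj₁ v) → lab A v ; (inj₂ ()) }
         ; top' = λ e → old (top A e)
         ; bot' = λ e → if e =ᵇ δ then old (bot A ε') else old (bot A e)
         }) B → A ⟶w B
  -- (3) weakening w, lower edge ε into cointeraction ci with other upper
  --     edge ε': delete w, ε; ci becomes a coweakening on ε'.
  w3 : (w ci : Fin (nV A)) (ε ε' : Fin (nE A)) →
       lab A w ≡ weakening → lab A ci ≡ cointeraction →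
       top A ε ≡ just w → bot A ε ≡ just ci →
       bot A ε' ≡ just ci → ε' ≢ ε →
       Realises {A} (record
         { k = 0
         ; keepV = λ v → not (v =ᵇ w)
         ; keepE = λ e → not (e =ᵇ ε)
         ; lab' = relabel A ci coweakening
         ; top' = λ e → old (top A e)
         ; bot' = λ e → old (bot A e)
         }) B → A ⟶w B
  -- (4) interaction i with lower edges ε ε', ε into coweakening z:
  --     delete z, ε; i becomes a weakening on ε'.
  w4 : (i z : Fin (nV A)) (ε ε' : Fin (nE A)) →
       lab A i ≡ interaction → lab A z ≡ coweakening →
       top A ε ≡ just i → bot A ε ≡ just z →
       top A ε' ≡ just i → ε' ≢ ε →
       Realises {A} (record
         { k = 0
         ; keepV = λ v → not (v =ᵇ z)
         ; keepE = λ e → not (e =ᵇ ε)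
         ; lab' = relabel A i weakening
         ; top' = λ e → old (top A e)
         ; bot' = λ e → old (bot A e)
         }) B → A ⟶w B
  -- (5) weakening w, lower edge ε into coweakening z: delete w, z, ε.
  w5 : (w z : Fin (nV A)) (ε : Fin (nE A)) →
       lab A w ≡ weakening → lab A z ≡ coweakening →
       top A ε ≡ just w → bot A ε ≡ just z →
       Realises {A} (record
         { k = 0
         ; keepV = λ v → not (v =ᵇ w) ∧ not (v =ᵇ z)
         ; keepE = λ e → not (e =ᵇ ε)
         ; lab' = λ { (inj₁ v) → lab A v ; (inj₂ ()) }
         ; top' = λ e → old (top A e)
         ; bot' = λ e → old (bot A e)
         }) B → A ⟶w B
  -- (6) weakening w, lower edge ε = upper edge of cocontraction k with lower
  --     edges ε₁ ε₂: delete w, ε; k becomes a weakening on ε₁ and a new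
  --     weakening is put on ε₂.
  w6 : (w k : Fin (nV A)) (ε ε₁ ε₂ : Fin (nE A)) →
       lab A w ≡ weakening → lab A k ≡ cocontraction →
       top A ε ≡ just w → bot A ε ≡ just k →
       top A ε₁ ≡ just k → top A ε₂ ≡ just k → ε₁ ≢ ε₂ →
       Realises {A} (record
         { k = 1
         ; keepV = λ v → not (v =ᵇ w)
         ; keepE = λ e → not (e =ᵇ ε)
         ; lab' = λ { (inj₁ v) → relabel A k weakening (inj₁ {B = Fin 1} v)
                    ; (inj₂ _) → weakening }
         ; top' = λ e → if e =ᵇ ε₂ then just (inj₂ zero) else old (top A e)
         ; bot' = λ e → old (bot A e)
         }) B → A ⟶w B
  -- (7) contraction c with upper edges ε₁ ε₂ and lower edge ε into a
  --     coweakening z: delete z, ε; c becomes a coweakening on ε₁ and a new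
  --     coweakening is put on ε₂.
  w7 : (c z : Fin (nV A)) (ε ε₁ ε₂ : Fin (nE A)) →
       lab A c ≡ contraction → lab A z ≡ coweakening →
       top A ε ≡ just c → bot A ε ≡ just z →
       bot A ε₁ ≡ just c → bot A ε₂ ≡ just c → ε₁ ≢ ε₂ →
       Realises {A} (record
         { k = 1
         ; keepV = λ v → not (v =ᵇ z)
         ; keepE = λ e → not (e =ᵇ ε)
         ; lab' = λ { (inj₁ v) → relabel A c coweakening (inj₁ {B = Fin 1} v)
                    ; (inj₂ _) → coweakening }
         ; top' = λ e → old (top A e)
         ; bot' = λ e → if e =ᵇ ε₂ then just (inj₂ zero) else old (bot A e)
         }) B → A ⟶w B

_⟶w*_ : Flow → Flow → Set
_⟶w*_ = Star _⟶w_

module Submission where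

-- We prove the contrapositive, step by step: every w-step A ⟶w B REFLECTS
-- c-redexes, i.e. a c-redex in B yields a c-redex in A.  A c-redex only
-- involves "active" vertices (interactions, cointeractions, contractions,
-- cocontractions) and the edges between them.  A w-rule never creates an
-- active vertex; it deletes vertices and edges, turns active vertices into
-- (co)weakenings and adds (co)weakenings.  So every active vertex of B comes
-- from an A-vertex with the same label, and its edges come from A-edges.
--
-- Rules w3–w7 keep the ends of every surviving edge at active vertices
-- unchanged: B "embeds exactly" into A and the redex is copied verbatim.
-- Rules w1 and w2 moreover merge an edge κ with an edge σ through a
-- (co)contraction m.  A redex of B using the merged edge κσ becomes, in A,
-- either the same redex with κσ replaced by σ, or a new redex through m.

open import Defs
open import Data.Nat using (ℕ)
open import Data.Bool using (true; if_then_else_; not; _∧_)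
open import Data.Fin using (Fin; zero)
open import Data.Fin.Properties using (_≟_)
open import Data.Maybe using (Maybe; just; nothing)
import Data.Maybe as M
open import Data.Sum using (_⊎_; inj₁; inj₂)
open import Data.Product using (Σ; ∃; _×_; _,_)
open import Data.Empty using (⊥-elim)
open import Function using (_∘_; id; Injective)
open import Relation.Nullary using (¬_; yes; no)
open import Relation.Binary.PropositionalEquality using (_≡_; _≢_; refl; sym; trans; cong; subst)
open import Relation.Binary.Construct.Closure.ReflexiveTransitive using (fold)

-- The kinds of vertex that occur in the left-hand sides of system c.
data Active : Kind → Set where
  interaction   : Active interaction
  cointeraction : Active cointeraction
  contraction   : Active contraction
  cocontraction : Active cocontraction

record Embedding (A B : Flow) : Set where
  field
    k     : ℕ
    ν     : Fin (nV B) → Fin (nV A) ⊎ Fin k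
    μ     : Fin (nE B) → Fin (nE A)
    μ-inj : Injective _≡_ _≡_ μ
    label-from : ∀ v K → Active K → lab B v ≡ K → ∃ λ u → ν v ≡ inj₁ u × lab A u ≡ K
    top-from   : ∀ b v u → top B b ≡ just v → ν v ≡ inj₁ u → top A (μ b) ≡ just u

  μ-≢ : ∀ {b b'} → b ≢ b' → μ b ≢ μ b'
  μ-≢ b≢b' = b≢b' ∘ μ-inj

record ExactEmbedding (A B : Flow) : Set where
  field
    embedding : Embedding A B
  open Embedding embedding public
  field
    bot-from : ∀ b v u → bot B b ≡ just v → ν v ≡ inj₁ u → bot A (μ b) ≡ just u

-- The vertex m through which w1 / w2 merge the edge κ (above m) with the edge
-- σ (below m), together with the other edge x at m that the rule deletes.
data MergePoint (A : Flow) (κ σ : Fin (nE A)) (m : Fin (nV A)) : Set where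
  contraction-point   : lab A m ≡ contraction →
                        ∀ x → bot A x ≡ just m → x ≢ κ → MergePoint A κ σ m
  cocontraction-point : lab A m ≡ cocontraction →
                        ∀ x → top A x ≡ just m → x ≢ σ → MergePoint A κ σ m

-- An embedding in which the A-edge κ, merged with the deleted edge σ, takes
-- over σ's lower end: a B-edge b has the lower end of μ b in A, or b is the
-- merged edge (μ b ≡ κ) and has the lower end of σ.
record MergeEmbedding (A B : Flow) : Set where
  field
    embedding : Embedding A B
  open Embedding embedding public
  field
    κ σ   : Fin (nE A)
    m     : Fin (nV A)
    point : MergePoint A κ σ m
    κ-bot : bot A κ ≡ just m
    σ-top : top A σ ≡ just m
    σ-gone : ∀ b → μ b ≢ σ
    bot-from : ∀ b v u → bot B b ≡ just v → ν v ≡ inj₁ u →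
               (μ b ≡ κ × bot A σ ≡ just u) ⊎ bot A (μ b) ≡ just u

module ExactReflection {A B : Flow} (e : ExactEmbedding A B) where
  open ExactEmbedding e

  exact-reflects : CRedex B → CRedex A
  exact-reflects (c1 c ci ε₁ ε₂ ε ε₃ lc lci b₁ b₂ d₁₂ tε bε b₃ d₃)
    with label-from c _ contraction lc | label-from ci _ cointeraction lci
  ... | u , p , l | u' , p' , l' =
    c1 u u' (μ ε₁) (μ ε₂) (μ ε) (μ ε₃) l l' (bot-from _ _ _ b₁ p) (bot-from _ _ _ b₂ p) (μ-≢ d₁₂)
       (top-from _ _ _ tε p) (bot-from _ _ _ bε p') (bot-from _ _ _ b₃ p') (μ-≢ d₃)
  exact-reflects (c2 i k ε₃ ε ε₁ ε₂ li lk t₃ tε d₃ bε t₁ t₂ d₁₂)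
    with label-from i _ interaction li | label-from k _ cocontraction lk
  ... | u , p , l | u' , p' , l' =
    c2 u u' (μ ε₃) (μ ε) (μ ε₁) (μ ε₂) l l' (top-from _ _ _ t₃ p) (top-from _ _ _ tε p) (μ-≢ d₃)
       (bot-from _ _ _ bε p') (top-from _ _ _ t₁ p') (top-from _ _ _ t₂ p') (μ-≢ d₁₂)
  exact-reflects (c3 c k ε₁ ε₂ ε ε₃ ε₄ lc lk b₁ b₂ d₁₂ tε bε t₃ t₄ d₃₄)
    with label-from c _ contraction lc | label-from k _ cocontraction lk
  ... | u , p , l | u' , p' , l' =
    c3 u u' (μ ε₁) (μ ε₂) (μ ε) (μ ε₃) (μ ε₄) l l' (bot-from _ _ _ b₁ p) (bot-from _ _ _ b₂ p)
       (μ-≢ d₁₂) (top-from _ _ _ tε p) (bot-from _ _ _ bε p') (top-from _ _ _ t₃ p')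
       (top-from _ _ _ t₄ p') (μ-≢ d₃₄)

open ExactReflection using (exact-reflects)

-- If the middle edge of a redex of B
-- (the one joining its two vertices) is not the merged edge, the redex is
-- copied, with σ standing in for a merged edge at its lower end.  If the
-- middle edge is the merged one, it yields a redex of A through m:
-- if m is a contraction the B-vertex above the merged edge is irrelevant
-- and m itself forms the redex with the vertex below σ; if m is a
-- cocontraction the B-vertex above forms the redex with m.

module MergeReflection {A B : Flow} (e : MergeEmbedding A B) where
  open MergeEmbedding e

  -- b is realised in A by the edge a (a = σ exactly when b is merged)
  Realised : Fin (nE B) → Fin (nE A) → Set
  Realised b a = (μ b ≡ κ × a ≡ σ) ⊎ a ≡ μ b

  lower-edge : ∀ b v u → bot B b ≡ just v → ν v ≡ inj₁ u →
               Σ (Fin (nE A)) λ a → bot A a ≡ just u × Realised b a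
  lower-edge b v u p q with bot-from b v u p q
  ... | inj₁ (merged , σ-bot) = σ , σ-bot , inj₁ (merged , refl)
  ... | inj₂ b-bot            = μ b , b-bot , inj₂ refl

  realised-≢-μ : ∀ {b a b'} → Realised b a → b ≢ b' → a ≢ μ b'
  realised-≢-μ (inj₁ (_ , refl)) _    q = σ-gone _ (sym q)
  realised-≢-μ (inj₂ refl)       b≢b' q = μ-≢ b≢b' q

  realised-≢ : ∀ {b₁ a₁ b₂ a₂} → Realised b₁ a₁ → Realised b₂ a₂ → b₁ ≢ b₂ → a₁ ≢ a₂
  realised-≢ (inj₁ (p , _))    (inj₁ (q , _)) d _ = μ-≢ d (trans p (sym q))
  realised-≢ (inj₁ (_ , refl)) (inj₂ refl)    _ q = σ-gone _ (sym q)
  realised-≢ (inj₂ refl)       r₂             d q = realised-≢-μ r₂ (d ∘ sym) (sym q)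

  κ-top : ∀ {b u} → μ b ≡ κ → top A (μ b) ≡ just u → top A κ ≡ just u
  κ-top merged = subst (λ a → top A a ≡ just _) merged

  reflect-c1 : ∀ {c ci ε₁ ε₂ ε ε₃} → lab B c ≡ contraction → lab B ci ≡ cointeraction →
    bot B ε₁ ≡ just c → bot B ε₂ ≡ just c → ε₁ ≢ ε₂ → top B ε ≡ just c →
    bot B ε ≡ just ci → bot B ε₃ ≡ just ci → ε₃ ≢ ε → CRedex A
  reflect-c1 {c} {ci} {ε = ε} lc lci b₁ b₂ d₁₂ tε bε b₃ d₃
    with label-from c _ contraction lc | label-from ci _ cointeraction lci
  ... | u , p , l | u' , p' , l'
    with lower-edge _ _ _ b₁ p | lower-edge _ _ _ b₂ p | bot-from _ _ _ bε p'
  ... | a₁ , ba₁ , r₁ | a₂ , ba₂ , r₂ | inj₂ bε' with lower-edge _ _ _ b₃ p'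
  ...   | a₃ , ba₃ , r₃ =
    c1 u u' a₁ a₂ (μ ε) a₃ l l' ba₁ ba₂ (realised-≢ r₁ r₂ d₁₂) (top-from _ _ _ tε p) bε' ba₃
       (realised-≢-μ r₃ d₃)
  reflect-c1 {ε₃ = ε₃} lc lci b₁ b₂ d₁₂ tε bε b₃ d₃
    | u , p , l | u' , p' , l' | a₁ , ba₁ , r₁ | a₂ , ba₂ , r₂ | inj₁ (merged , σ-bot)
    with point
  ... | contraction-point lm x bx x≢κ with bot-from _ _ _ b₃ p'
  ...   | inj₁ (merged₃ , _) = ⊥-elim (d₃ (μ-inj (trans merged₃ (sym merged))))
  ...   | inj₂ bε₃ = c1 m u' x κ σ (μ ε₃) lm l' bx κ-bot x≢κ σ-top σ-bot bε₃ (σ-gone ε₃)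
  reflect-c1 lc lci b₁ b₂ d₁₂ tε bε b₃ d₃
    | u , p , l | u' , p' , l' | a₁ , ba₁ , r₁ | a₂ , ba₂ , r₂ | inj₁ (merged , σ-bot)
    | cocontraction-point lm x tx x≢σ =
    c3 u m a₁ a₂ κ x σ l lm ba₁ ba₂ (realised-≢ r₁ r₂ d₁₂) (κ-top merged (top-from _ _ _ tε p))
       κ-bot tx σ-top x≢σ

  reflect-c2 : ∀ {i k ε₃ ε ε₁ ε₂} → lab B i ≡ interaction → lab B k ≡ cocontraction →
    top B ε₃ ≡ just i → top B ε ≡ just i → ε₃ ≢ ε → bot B ε ≡ just k →
    top B ε₁ ≡ just k → top B ε₂ ≡ just k → ε₁ ≢ ε₂ → CRedex A
  reflect-c2 {i} {k} {ε₃} {ε} {ε₁} {ε₂} li lk t₃ tε d₃ bε t₁ t₂ d₁₂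
    with label-from i _ interaction li | label-from k _ cocontraction lk
  ... | u , p , l | u' , p' , l' with bot-from _ _ _ bε p' | point
  ... | inj₂ bε' | _ =
    c2 u u' (μ ε₃) (μ ε) (μ ε₁) (μ ε₂) l l' (top-from _ _ _ t₃ p) (top-from _ _ _ tε p) (μ-≢ d₃)
       bε' (top-from _ _ _ t₁ p') (top-from _ _ _ t₂ p') (μ-≢ d₁₂)
  ... | inj₁ (merged , σ-bot) | contraction-point lm x bx x≢κ =
    c3 m u' x κ σ (μ ε₁) (μ ε₂) lm l' bx κ-bot x≢κ σ-top σ-bot (top-from _ _ _ t₁ p')
       (top-from _ _ _ t₂ p') (μ-≢ d₁₂)
  ... | inj₁ (merged , σ-bot) | cocontraction-point lm x tx x≢σ =
    c2 u m (μ ε₃) κ x σ l lm (top-from _ _ _ t₃ p) (κ-top merged (top-from _ _ _ tε p))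
       (λ q → μ-≢ d₃ (trans q (sym merged))) κ-bot tx σ-top x≢σ

  reflect-c3 : ∀ {c k ε₁ ε₂ ε ε₃ ε₄} → lab B c ≡ contraction → lab B k ≡ cocontraction →
    bot B ε₁ ≡ just c → bot B ε₂ ≡ just c → ε₁ ≢ ε₂ → top B ε ≡ just c →
    bot B ε ≡ just k → top B ε₃ ≡ just k → top B ε₄ ≡ just k → ε₃ ≢ ε₄ → CRedex A
  reflect-c3 {c} {k} {ε = ε} {ε₃} {ε₄} lc lk b₁ b₂ d₁₂ tε bε t₃ t₄ d₃₄
    with label-from c _ contraction lc | label-from k _ cocontraction lk
  ... | u , p , l | u' , p' , l'
    with lower-edge _ _ _ b₁ p | lower-edge _ _ _ b₂ p | bot-from _ _ _ bε p' | point
  ... | a₁ , ba₁ , r₁ | a₂ , ba₂ , r₂ | inj₂ bε' | _ =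
    c3 u u' a₁ a₂ (μ ε) (μ ε₃) (μ ε₄) l l' ba₁ ba₂ (realised-≢ r₁ r₂ d₁₂) (top-from _ _ _ tε p)
       bε' (top-from _ _ _ t₃ p') (top-from _ _ _ t₄ p') (μ-≢ d₃₄)
  ... | _ | _ | inj₁ (merged , σ-bot) | contraction-point lm x bx x≢κ =
    c3 m u' x κ σ (μ ε₃) (μ ε₄) lm l' bx κ-bot x≢κ σ-top σ-bot (top-from _ _ _ t₃ p')
       (top-from _ _ _ t₄ p') (μ-≢ d₃₄)
  ... | a₁ , ba₁ , r₁ | a₂ , ba₂ , r₂ | inj₁ (merged , σ-bot) | cocontraction-point lm x tx x≢σ =
    c3 u m a₁ a₂ κ x σ l lm ba₁ ba₂ (realised-≢ r₁ r₂ d₁₂) (κ-top merged (top-from _ _ _ tε p))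
       κ-bot tx σ-top x≢σ

  merge-reflects : CRedex B → CRedex A
  merge-reflects (c1 _ _ _ _ _ _ lc lci b₁ b₂ d₁₂ tε bε b₃ d₃) =
    reflect-c1 lc lci b₁ b₂ d₁₂ tε bε b₃ d₃
  merge-reflects (c2 _ _ _ _ _ _ li lk t₃ tε d₃ bε t₁ t₂ d₁₂) =
    reflect-c2 li lk t₃ tε d₃ bε t₁ t₂ d₁₂
  merge-reflects (c3 _ _ _ _ _ _ _ lc lk b₁ b₂ d₁₂ tε bε t₃ t₄ d₃₄) =
    reflect-c3 lc lk b₁ b₂ d₁₂ tε bε t₃ t₄ d₃₄

open MergeReflection using (merge-reflects)

-- The rules only produce edge ends of the
-- forms `old m`, an `if` between `old` ends, or an `if` producing a fresh
-- vertex; and only labels that are either old or inactive.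

old-end : ∀ {n k} {m : Maybe (Fin n)} {u} → just (inj₁ {B = Fin k} u) ≡ old m → m ≡ just u
old-end {m = just _}  refl = refl
old-end {m = nothing} ()

fresh-or-old-end : ∀ {n e} (x y : Fin e) (m : Maybe (Fin n)) u →
  just (inj₁ {B = Fin 1} u) ≡ (if x =ᵇ y then just (inj₂ zero) else old m) → m ≡ just u
fresh-or-old-end x y m u p with x ≟ y
... | yes _ = ⊥-elim (inj₁≢inj₂ p)
  where
  inj₁≢inj₂ : ∀ {n} {u : Fin n} → just (inj₁ {B = Fin 1} u) ≢ just (inj₂ zero)
  inj₁≢inj₂ ()
... | no _  = old-end p

choice-end : ∀ {n e} (x y : Fin e) (m₁ m₂ : Maybe (Fin n)) u →
  just (inj₁ {B = Fin 0} u) ≡ (if x =ᵇ y then old m₁ else old m₂) →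
  (x ≡ y × m₁ ≡ just u) ⊎ m₂ ≡ just u
choice-end x y m₁ m₂ u p with x ≟ y
... | yes x≡y = inj₁ (x≡y , old-end p)
... | no _    = inj₂ (old-end p)

relabel-inactive : ∀ {k} (A : Flow) x K → ¬ Active K → ∀ u →
  Active (relabel A {k} x K (inj₁ u)) → relabel A {k} x K (inj₁ u) ≡ lab A u
relabel-inactive A x K inactive u act with u ≟ x
... | yes _ = ⊥-elim (inactive act)
... | no _  = refl

kept-≢ : ∀ {n} (a b e : Fin n) → (not (e =ᵇ a) ∧ not (e =ᵇ b)) ≡ true → e ≢ b
kept-≢ a b e kept refl with e ≟ e
... | no e≢e = e≢e refl
... | yes _ with e ≟ a
kept-≢ a b e () refl | yes _ | yes _
kept-≢ a b e () refl | yes _ | no _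

module FromRealisation {A : Flow} {S : Spec A} {B : Flow} (R : Realises S B) where
  open Realises R

  label-from : (∀ u → Active (Spec.lab' S (inj₁ u)) → Spec.lab' S (inj₁ u) ≡ lab A u) →
               (∀ j → ¬ Active (Spec.lab' S (inj₂ j))) →
               ∀ v K → Active K → lab B v ≡ K → ∃ λ u → ν v ≡ inj₁ u × lab A u ≡ K
  label-from old-labels new-inactive v K act lv with ν v | lab≡ v
  ... | inj₁ u | l≡ = u , refl , trans (sym (old-labels u (subst Active (trans (sym lv) l≡) act)))
                                       (trans (sym l≡) lv)
  ... | inj₂ j | l≡ = ⊥-elim (new-inactive j (subst Active (trans (sym lv) l≡) act))

  top-end : ∀ b v u → top B b ≡ just v → ν v ≡ inj₁ u → just (inj₁ u) ≡ Spec.top' S (μ b)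
  top-end b v u tb νv = trans (cong just (sym νv)) (subst (λ t → M.map ν t ≡ _) tb (top≡ b))

  bot-end : ∀ b v u → bot B b ≡ just v → ν v ≡ inj₁ u → just (inj₁ u) ≡ Spec.bot' S (μ b)
  bot-end b v u bb νv = trans (cong just (sym νv)) (subst (λ t → M.map ν t ≡ _) bb (bot≡ b))

  embedding : (∀ u → Active (Spec.lab' S (inj₁ u)) → Spec.lab' S (inj₁ u) ≡ lab A u) →
              (∀ j → ¬ Active (Spec.lab' S (inj₂ j))) →
              (∀ b u → just (inj₁ u) ≡ Spec.top' S (μ b) → top A (μ b) ≡ just u) →
              Embedding A B
  embedding old-labels new-inactive old-tops = record
    { k = Spec.k S ; ν = ν ; μ = μ ; μ-inj = μ-inj
    ; label-from = label-from old-labels new-inactive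
    ; top-from = λ b v u tb νv → old-tops b u (top-end b v u tb νv) }

open FromRealisation using (embedding; bot-end)

w-step-reflects : ∀ {A B} → A ⟶w B → CRedex B → CRedex A
w-step-reflects {A} (w1 _ c ε ε' δ _ lc _ bε bε' ε'≢ε tδ R) = merge-reflects record
  { embedding = embedding R (λ _ _ → refl) (λ ()) (λ _ _ → old-end)
  ; κ = ε' ; σ = δ ; m = c
  ; point = contraction-point lc ε bε (ε'≢ε ∘ sym)
  ; κ-bot = bε' ; σ-top = tδ
  ; σ-gone = λ b → kept-≢ ε δ (μ b) (μ-ok b)
  ; bot-from = λ b v u bb νv → choice-end (μ b) ε' (bot A δ) (bot A (μ b)) u (bot-end R b v u bb νv) }
  where open Realises R
w-step-reflects {A} (w2 k _ δ ε ε' lk _ tε _ tε' ε'≢ε bδ R) = merge-reflects record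
  { embedding = embedding R (λ _ _ → refl) (λ ()) (λ _ _ → old-end)
  ; κ = δ ; σ = ε' ; m = k
  ; point = cocontraction-point lk ε tε (ε'≢ε ∘ sym)
  ; κ-bot = bδ ; σ-top = tε'
  ; σ-gone = λ b → kept-≢ ε ε' (μ b) (μ-ok b)
  ; bot-from = λ b v u bb νv → choice-end (μ b) δ (bot A ε') (bot A (μ b)) u (bot-end R b v u bb νv) }
  where open Realises R
w-step-reflects {A} (w3 _ ci _ _ _ _ _ _ _ _ R) = exact-reflects record
  { embedding = embedding R (relabel-inactive {k = 0} A ci coweakening (λ ())) (λ ()) (λ _ _ → old-end)
  ; bot-from = λ b v u bb νv → old-end (bot-end R b v u bb νv) }
w-step-reflects {A} (w4 i _ _ _ _ _ _ _ _ _ R) = exact-reflects record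
  { embedding = embedding R (relabel-inactive {k = 0} A i weakening (λ ())) (λ ()) (λ _ _ → old-end)
  ; bot-from = λ b v u bb νv → old-end (bot-end R b v u bb νv) }
w-step-reflects {A} (w5 _ _ _ _ _ _ _ R) = exact-reflects record
  { embedding = embedding R (λ _ _ → refl) (λ ()) (λ _ _ → old-end)
  ; bot-from = λ b v u bb νv → old-end (bot-end R b v u bb νv) }
w-step-reflects {A} (w6 _ k _ _ ε₂ _ _ _ _ _ _ _ R) = exact-reflects record
  { embedding = embedding R (relabel-inactive {k = 1} A k weakening (λ ())) (λ _ ())
                  (λ b u → fresh-or-old-end (μ b) ε₂ (top A (μ b)) u)
  ; bot-from = λ b v u bb νv → old-end (bot-end R b v u bb νv) }
  where open Realises R
w-step-reflects {A} (w7 c _ _ _ ε₂ _ _ _ _ _ _ _ R) = exact-reflects record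
  { embedding = embedding R (relabel-inactive {k = 1} A c coweakening (λ ())) (λ _ ())
                  (λ _ _ → old-end)
  ; bot-from = λ b v u bb νv → fresh-or-old-end (μ b) ε₂ (bot A (μ b)) u (bot-end R b v u bb νv) }
  where open Realises R

w-reduction-reflects : ∀ {A B} → A ⟶w* B → CRedex B → CRedex A
w-reduction-reflects = fold (λ A B → CRedex B → CRedex A) (λ step rest → w-step-reflects step ∘ rest) id

-- Proposition 4.19.
proposition4p19 : (A B : Flow) → IsAtomicFlow A → NormalC A → A ⟶w* B → NormalC B
proposition4p19 A B _ normal-A reduction redex-B = normal-A (w-reduction-reflects reduction redex-B)
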